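{- Define the Yellowstone sequence $(a(n))_{n\ge 1}$ by $a(1)=1$, $a(2)=2$, $a(3)=3$, and, for each $n>3$, let $a(n)$ be the smallest positive integer $k$ not in $\{a(1),\dots,a(n-1)\}$ such that $\gcd(a(n-2),k)>1$ and $\gcd(a(n-1),k)=1$. Then the sequence $(a(n))_{n\ge1}$ is a permutation of the positive integers, i.e. every positive integer occurs in it exactly once.
   Context: The sequence is OEIS A098550; it is the lexicographically earliest sequence of distinct positive integers with $a(1)=1,a(2)=2,a(3)=3$ satisfying $\gcd(a(n-2),a(n))>1$ and $\gcd(a(n-1),a(n))=1$ for all $n>3$. -}

module Defs where

open import Data.Nat using (ℕ; zero; suc; _∸_; _≤_; _<_)
open import Data.Nat.GCD using (gcd)
open import Data.Product using (_×_; ∃-syntax)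
open import Relation.Binary.PropositionalEquality using (_≡_; _≢_)

-- Sequences are functions ℕ → ℕ indexed from 1 (the value at 0 is ignored).

Admissible : (ℕ → ℕ) → ℕ → ℕ → Set
Admissible a n k =
  (0 < k)
  × (∀ i → 1 ≤ i → i < n → a i ≢ k)
  × (1 < gcd (a (n ∸ 2)) k)
  × (gcd (a (n ∸ 1)) k ≡ 1)

IsYellowstone : (ℕ → ℕ) → Set
IsYellowstone a =
  (a 1 ≡ 1) × (a 2 ≡ 2) × (a 3 ≡ 3)
  × (∀ n → 3 < n → Admissible a n (a n) × (∀ k → Admissible a n k → a n ≤ k))

IsPermOfPositives : (ℕ → ℕ) → Set
IsPermOfPositives a =
  (∀ n → 1 ≤ n → 0 < a n)
  × (∀ m → 0 < m → ∃[ n ] (1 ≤ n × a n ≡ m))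
  × (∀ i j → 1 ≤ i → 1 ≤ j → a i ≡ a j → i ≡ j)

-- Existence: a(n) is found by a bounded search, since
-- a(n-2)·(1 + a(n-1)·Σ_{i<n} a(i)) is always admissible.
--
-- Every prime p divides infinitely many terms: if p divided no term from N
-- on, then with C = p^(1 + Σ_{i<N+2} a(i)), t·C would be admissible at
-- position m+2 whenever 2 ≤ t ∣ a(m), so a(m+2) ≤ t·C.
-- Then a(m+4) > C² forces a(m+2) to be a prime dividing a(m), and two such
-- excesses in a row would give a(m+2) = a(m+4). So infinitely many terms are
-- at most C², contradicting injectivity.
--
-- Now let m ≥ 2 with prime factor p. Terms sharing a factor with m occur
-- infinitely often (multiples of p), and so do terms coprime to m (the term
-- after a multiple of p when m = p, large primes otherwise), hence so do
-- switches from the former to the latter. At each switch m is admissible two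
-- positions later unless it has already occurred; if it never occurred,
-- infinitely many distinct terms would be smaller than m.
module Submission where

open import Defs
open import Data.Empty using (⊥; ⊥-elim)
open import Data.Fin using (Fin; toℕ; fromℕ<)
import Data.Fin.Properties as Fin
open import Data.List using ([]; _∷_)
open import Data.List.Relation.Unary.All using (_∷_)
open import Data.Nat
open import Data.Nat.Combinatorics using (k![n∸k]!∣n!)
open import Data.Nat.Coprimality
  using (Coprime; coprime⇒gcd≡1; gcd≡1⇒coprime; coprime-divisor; prime⇒coprime)
  renaming (sym to coprime-sym)
open import Data.Nat.Divisibility
open import Data.Nat.GCD
open import Data.Nat.ListAction using (product)
open import Data.Nat.Primality
open import Data.Nat.Primality.Factorisation using (factorise)
open import Data.Nat.Properties
open import Data.Product using (_×_; _,_; proj₁; proj₂; ∃-syntax)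
open import Data.Sum using (inj₁; inj₂)
open import Function using (_∘_)
open import Relation.Binary.Definitions using (tri<; tri≈; tri>)
open import Relation.Binary.PropositionalEquality
open import Relation.Nullary using (Dec; yes; no; ¬_; contradiction; _×-dec_; ¬?; _→-dec_)
open import Relation.Nullary.Decidable using (map′)

-- Divisibility and coprimality

prime⇒2≤ : ∀ {p} → Prime p → 2 ≤ p
prime⇒2≤ {p} p-prime = nonTrivial⇒n>1 p {{prime⇒nonTrivial p-prime}}

∃-prime-divisor : ∀ {n} → 2 ≤ n → ∃[ p ] (Prime p × p ∣ n)
∃-prime-divisor {n} 2≤n with factorise n {{>-nonZero (≤-trans (s≤s z≤n) 2≤n)}}
... | record { factors = [] ; isFactorisation = n≡1 } = contradiction n≡1 (>⇒≢ 2≤n)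
... | record { factors = p ∷ ps ; isFactorisation = n≡p*Πps ; factorsPrime = p-prime ∷ _ } =
  p , p-prime , divides (product ps) (trans n≡p*Πps (*-comm p (product ps)))

∣n! : ∀ {r n} → 1 ≤ r → r ≤ n → r ∣ n !
∣n! {suc r} {n} _ r<n =
  ∣-trans (m∣m*n (r !)) (∣-trans (m∣m*n ((n ∸ suc r) !)) (k![n∸k]!∣n! r<n))

∃-prime> : ∀ n → ∃[ q ] (Prime q × n < q)
∃-prime> n =
  let q , q-prime , q∣n!+1 = ∃-prime-divisor (+-monoˡ-≤ 1 (1≤n! n))
      q≡1 q≤n = ∣1⇒≡1 (∣m+n∣m⇒∣n q∣n!+1 (∣n! (≤-trans (s≤s z≤n) (prime⇒2≤ q-prime)) q≤n))
  in q , q-prime , ≰⇒> λ q≤n → ¬prime[1] (subst Prime (q≡1 q≤n) q-prime)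

prime∣prime⇒≡ : ∀ {p q} → Prime p → Prime q → p ∣ q → p ≡ q
prime∣prime⇒≡ p-prime q-prime p∣q with prime⇒irreducible q-prime p∣q
... | inj₁ refl = contradiction p-prime ¬prime[1]
... | inj₂ p≡q  = p≡q

∤⇒coprime : ∀ {p m} → Prime p → ¬ p ∣ m → Coprime m p
∤⇒coprime p-prime p∤m (d∣m , d∣p) with prime⇒irreducible p-prime d∣p
... | inj₁ d≡1  = d≡1
... | inj₂ refl = contradiction d∣m p∤m

coprime-*ʳ : ∀ {m x y} → Coprime m x → Coprime m y → Coprime m (x * y)
coprime-*ʳ m⊥x m⊥y (d∣m , d∣xy) =
  m⊥y (d∣m , coprime-divisor (λ (e∣d , e∣x) → m⊥x (∣-trans e∣d d∣m , e∣x)) d∣xy)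

coprime-^ʳ : ∀ {m x} → Coprime m x → ∀ e → Coprime m (x ^ e)
coprime-^ʳ m⊥x zero    (_ , d∣1) = ∣1⇒≡1 d∣1
coprime-^ʳ m⊥x (suc e) = coprime-*ʳ m⊥x (coprime-^ʳ m⊥x e)

1<gcd : ∀ {d x y} → 2 ≤ d → d ∣ x → d ∣ y → 0 < y → 1 < gcd x y
1<gcd {d} {x} {y} 2≤d d∣x d∣y 0<y =
  ≤-trans 2≤d (∣⇒≤ {{≢-nonZero (gcd[m,n]≢0 x y (inj₂ (>⇒≢ 0<y)))}} (gcd-greatest d∣x d∣y))

1<gcd⇒∃-prime : ∀ {x y} → 1 < gcd x y → ∃[ p ] (Prime p × p ∣ x × p ∣ y)
1<gcd⇒∃-prime {x} {y} 1<g =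
  let p , p-prime , p∣g = ∃-prime-divisor 1<g
  in p , p-prime , ∣-trans p∣g (gcd[m,n]∣m x y) , ∣-trans p∣g (gcd[m,n]∣n x y)

≯1⇒gcd≡1 : ∀ {x y} → 0 < y → ¬ 1 < gcd x y → gcd x y ≡ 1
≯1⇒gcd≡1 {x} {y} 0<y ≯1 with gcd x y | gcd[m,n]≢0 x y (inj₂ (>⇒≢ 0<y))
... | zero        | g≢0 = contradiction refl g≢0
... | suc zero    | _   = refl
... | suc (suc _) | _   = contradiction (s≤s (s≤s z≤n)) ≯1

n<m^n : ∀ {m} → 1 < m → ∀ n → n < m ^ n
n<m^n     1<m zero    = s≤s z≤n
n<m^n {m} 1<m (suc n) = ≤-<-trans (n<m^n 1<m n) (^-monoʳ-< m 1<m (n<1+n n))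

-- Searching, counting and enumerating

sumBelow : (ℕ → ℕ) → ℕ → ℕ
sumBelow g zero    = 0
sumBelow g (suc n) = g n + sumBelow g n

≤-sumBelow : ∀ g {i n} → i < n → g i ≤ sumBelow g n
≤-sumBelow g {i} {suc n} i<1+n with m<1+n⇒m<n∨m≡n i<1+n
... | inj₁ i<n  = ≤-trans (≤-sumBelow g i<n) (m≤n+m (sumBelow g n) (g n))
... | inj₂ refl = m≤m+n (g i) (sumBelow g n)

module LeastSearch {P : ℕ → Set} (P? : ∀ n → Dec (P n)) where

  least≤ : ℕ → ℕ
  least≤ zero = zero
  least≤ (suc b) with P? (least≤ b)
  ... | yes _ = least≤ b
  ... | no  _ = suc b

  least≤-sound : ∀ b {c} → P c → c ≤ b → P (least≤ b)
  least≤-sound zero    Pc z≤n = Pc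
  least≤-sound (suc b) {c} Pc c≤1+b with P? (least≤ b)
  ... | yes Pk = Pk
  ... | no ¬Pk with m≤n⇒m<n∨m≡n c≤1+b
  ...   | inj₁ c≤b  = contradiction (least≤-sound b Pc (≤-pred c≤b)) ¬Pk
  ...   | inj₂ refl = Pc

  least≤-minimal : ∀ b {c} → P c → least≤ b ≤ c
  least≤-minimal zero    Pc = z≤n
  least≤-minimal (suc b) {c} Pc with P? (least≤ b)
  ... | yes _  = least≤-minimal b Pc
  ... | no ¬Pk = ≰⇒> (λ c≤b → ¬Pk (least≤-sound b Pc c≤b))

∃-exit : ∀ {P : ℕ → Set} → (∀ n → Dec (P n)) → ∀ {s e} → s ≤ e → P s → ¬ P e →
         ∃[ k ] (s ≤ k × P k × ¬ P (suc k))
∃-exit P? {e = zero} z≤n Ps ¬Pe = contradiction Ps ¬Pe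
∃-exit {P} P? {s} {suc e} s≤1+e Ps ¬P[1+e] = exit (P? e)
  where
  s≤e : s ≤ e
  s≤e = ≤-pred (≤∧≢⇒< s≤1+e λ { refl → ¬P[1+e] Ps })
  exit : Dec (P e) → ∃[ k ] (s ≤ k × P k × ¬ P (suc k))
  exit (yes Pe)  = e , s≤e , Pe , ¬P[1+e]
  exit (no  ¬Pe) = ∃-exit P? s≤e Ps ¬Pe

StrictlyIncreasing : (ℕ → ℕ) → Set
StrictlyIncreasing ι = ∀ j → ι j < ι (suc j)

strictlyIncreasing-monotone : ∀ {ι} → StrictlyIncreasing ι → ∀ {i j} → i ≤ j → ι i ≤ ι j
strictlyIncreasing-monotone ι↑ {j = zero}  z≤n = ≤-refl
strictlyIncreasing-monotone ι↑ {i} {suc j} i≤1+j with m≤n⇒m<n∨m≡n i≤1+j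
... | inj₁ i≤j  = ≤-trans (strictlyIncreasing-monotone ι↑ (≤-pred i≤j)) (<⇒≤ (ι↑ j))
... | inj₂ refl = ≤-refl

strictlyIncreasing-< : ∀ {ι} → StrictlyIncreasing ι → ∀ {i j} → i < j → ι i < ι j
strictlyIncreasing-< ι↑ {i} {suc j} i<1+j = <-≤-trans (ι↑ i) (strictlyIncreasing-monotone ι↑ i<1+j)

Unbounded : (ℕ → Set) → Set
Unbounded P = ∀ N → ∃[ n ] (N ≤ n × P n)

unbounded⇒enumeration : ∀ {P} → Unbounded P → ∀ N →
                        ∃[ ι ] (StrictlyIncreasing ι × N ≤ ι 0 × (∀ j → P (ι j)))
unbounded⇒enumeration {P} unbounded N = ι , ι↑ , proj₁ (proj₂ (unbounded N)) , P-ι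
  where
  ι : ℕ → ℕ
  ι zero    = proj₁ (unbounded N)
  ι (suc j) = proj₁ (unbounded (suc (ι j)))
  ι↑ : StrictlyIncreasing ι
  ι↑ j = proj₁ (proj₂ (unbounded (suc (ι j))))
  P-ι : ∀ j → P (ι j)
  P-ι zero    = proj₂ (proj₂ (unbounded N))
  P-ι (suc j) = proj₂ (proj₂ (unbounded (suc (ι j))))

pigeonhole : ∀ {B} (g : ℕ → ℕ) → (∀ j → j ≤ B → g j < B) → ∃[ i ] ∃[ j ] (i < j × g i ≡ g j)
pigeonhole {B} g g<B =
  let i , j , i<j , g′i≡g′j = Fin.pigeonhole (n<1+n B) g′ in toℕ i , toℕ j , i<j , from-g′ g′i≡g′j
  where
  g′ : Fin (suc B) → Fin B
  g′ k = fromℕ< (g<B (toℕ k) (Fin.toℕ≤pred[n] k))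
  from-g′ : ∀ {i j} → g′ i ≡ g′ j → g (toℕ i) ≡ g (toℕ j)
  from-g′ eq = trans (sym (Fin.toℕ-fromℕ< _)) (trans (cong toℕ eq) (Fin.toℕ-fromℕ< _))

-- Existence

admissible? : ∀ g n k → Dec (Admissible g n k)
admissible? g n k =
  (0 <? k) ×-dec (fresh? ×-dec ((1 <? gcd (g (n ∸ 2)) k) ×-dec (gcd (g (n ∸ 1)) k ≟ 1)))
  where
  fresh? : Dec (∀ i → 1 ≤ i → i < n → g i ≢ k)
  fresh? = map′ (λ fresh i 1≤i i<n → fresh {i} i<n 1≤i)
                (λ fresh {i} i<n 1≤i → fresh i 1≤i i<n)
                (allUpTo? (λ i → 1 ≤? i →-dec ¬? (g i ≟ k)) n)

Admissible-cong : ∀ {g h n k} → (∀ i → i < suc n → g i ≡ h i) →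
                  Admissible g (suc n) k → Admissible h (suc n) k
Admissible-cong {g} {h} {n} {k} g≗h (0<k , fresh , shares , coprime) =
  0<k ,
  (λ i 1≤i i<1+n → fresh i 1≤i i<1+n ∘ trans (g≗h i i<1+n)) ,
  subst (λ x → 1 < gcd x k) (g≗h (n ∸ 1) (s≤s (m∸n≤m n 1))) shares ,
  subst (λ x → gcd x k ≡ 1) (g≗h n ≤-refl) coprime

candidate : (ℕ → ℕ) → ℕ → ℕ
candidate g n = g (n ∸ 2) * suc (g (n ∸ 1) * sumBelow g n)

candidate-admissible : ∀ g n → 2 ≤ g (n ∸ 2) → 0 < g (n ∸ 1) →
                       gcd (g (n ∸ 2)) (g (n ∸ 1)) ≡ 1 → Admissible g n (candidate g n)
candidate-admissible g n 2≤x 0<y x⊥y =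
  0<c , fresh , 1<gcd 2≤x ∣-refl (m∣m*n r) 0<c , coprime⇒gcd≡1 (coprime-*ʳ y⊥x y⊥r)
  where
  x y S r : ℕ
  x = g (n ∸ 2)
  y = g (n ∸ 1)
  S = sumBelow g n
  r = suc (y * S)
  instance
    x≢0 : NonZero x
    x≢0 = >-nonZero (≤-trans (s≤s z≤n) 2≤x)
    y≢0 : NonZero y
    y≢0 = >-nonZero 0<y
  S<c : S < x * r
  S<c = ≤-trans (s≤s (m≤n*m S y)) (m≤n*m r x)
  0<c : 0 < x * r
  0<c = ≤-<-trans z≤n S<c
  fresh : ∀ i → 1 ≤ i → i < n → g i ≢ x * r
  fresh i _ i<n g[i]≡c = <⇒≱ S<c (subst (_≤ S) g[i]≡c (≤-sumBelow g i<n))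
  y⊥x : Coprime y x
  y⊥x = coprime-sym (gcd≡1⇒coprime x⊥y)
  y⊥r : Coprime y r
  y⊥r {d} (d∣y , d∣r) =
    ∣1⇒≡1 (∣m+n∣m⇒∣n (subst (d ∣_) (+-comm 1 (y * S)) d∣r) (∣m⇒∣m*n S d∣y))

nextTerm : (ℕ → ℕ) → ℕ → ℕ
nextTerm g n@(suc (suc (suc (suc _)))) =
  LeastSearch.least≤ (admissible? g n) (candidate g n)
nextTerm g n = n

prefix : ℕ → ℕ → ℕ
prefix zero    i = 0
prefix (suc n) i with i ≤? n
... | yes _ = prefix n i
... | no  _ = nextTerm (prefix n) (suc n)

yellowstone : ℕ → ℕ
yellowstone n = prefix n n

yellowstone-suc : ∀ n → yellowstone (suc n) ≡ nextTerm (prefix n) (suc n)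
yellowstone-suc n with suc n ≤? n
... | yes 1+n≤n = contradiction 1+n≤n (<-irrefl refl)
... | no  _     = refl

prefix-agrees : ∀ {n i} → i ≤ n → prefix n i ≡ yellowstone i
prefix-agrees {zero} z≤n = refl
prefix-agrees {suc n} {i} i≤1+n with i ≤? n
... | yes i≤n = prefix-agrees i≤n
... | no  i≰n with m≤n⇒m<n∨m≡n i≤1+n
...   | inj₁ i≤n  = contradiction (≤-pred i≤n) i≰n
...   | inj₂ refl = sym (yellowstone-suc n)

TailCoprime : ℕ → Set
TailCoprime k = 2 ≤ yellowstone (2 + k) × 2 ≤ yellowstone (3 + k)
              × gcd (yellowstone (2 + k)) (yellowstone (3 + k)) ≡ 1

yellowstone-rule : ∀ k → TailCoprime k →
  Admissible yellowstone (4 + k) (yellowstone (4 + k))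
  × (∀ c → Admissible yellowstone (4 + k) c → yellowstone (4 + k) ≤ c)
yellowstone-rule k (2≤x , 2≤y , x⊥y) =
  subst (Admissible a n) (sym a[n]≡least) (Admissible-cong g≗a least-admissible) ,
  λ c adm → subst (_≤ c) (sym a[n]≡least)
                     (least≤-minimal (candidate g n) (Admissible-cong a≗g adm))
  where
  a g : ℕ → ℕ
  a = yellowstone
  g = prefix (3 + k)
  n : ℕ
  n = 4 + k
  open LeastSearch (admissible? g n)
  g≗a : ∀ i → i < n → g i ≡ a i
  g≗a i i<n = prefix-agrees (≤-pred i<n)
  a≗g : ∀ i → i < n → a i ≡ g i
  a≗g i i<n = sym (g≗a i i<n)
  g[2+k]≡ : g (2 + k) ≡ a (2 + k)
  g[2+k]≡ = g≗a (2 + k) (s≤s (n≤1+n (2 + k)))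
  g[3+k]≡ : g (3 + k) ≡ a (3 + k)
  g[3+k]≡ = g≗a (3 + k) ≤-refl
  candidate-admissible′ : Admissible g n (candidate g n)
  candidate-admissible′ = candidate-admissible g n
    (subst (2 ≤_) (sym g[2+k]≡) 2≤x)
    (subst (0 <_) (sym g[3+k]≡) (≤-trans (s≤s z≤n) 2≤y))
    (subst₂ (λ x y → gcd x y ≡ 1) (sym g[2+k]≡) (sym g[3+k]≡) x⊥y)
  least-admissible : Admissible g n (least≤ (candidate g n))
  least-admissible = least≤-sound (candidate g n) candidate-admissible′ ≤-refl
  a[n]≡least : a n ≡ least≤ (candidate g n)
  a[n]≡least = yellowstone-suc (3 + k)

tailCoprime : ∀ k → TailCoprime k
tailCoprime zero    = s≤s (s≤s z≤n) , s≤s (s≤s z≤n) , refl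
tailCoprime (suc k) with yellowstone-rule k (tailCoprime k)
... | (0<a , fresh , _ , coprime) , _ =
  proj₁ (proj₂ (tailCoprime k)) , ≤∧≢⇒< 0<a (fresh 1 ≤-refl (s≤s (s≤s z≤n))) , coprime

yellowstone-isYellowstone : IsYellowstone yellowstone
yellowstone-isYellowstone = refl , refl , refl , rule
  where
  rule : ∀ n → 3 < n → Admissible yellowstone n (yellowstone n)
                     × (∀ c → Admissible yellowstone n c → yellowstone n ≤ c)
  rule (suc (suc (suc (suc k)))) _ = yellowstone-rule k (tailCoprime k)
  rule (suc (suc (suc zero))) (s≤s (s≤s (s≤s ())))
  rule (suc (suc zero)) (s≤s (s≤s ()))
  rule (suc zero) (s≤s ())

-- Every Yellowstone sequence is a permutation

GcdConditions : (ℕ → ℕ) → ℕ → ℕ → Set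
GcdConditions a n k = 1 < gcd (a (n ∸ 2)) k × gcd (a (n ∸ 1)) k ≡ 1

gcdConditions-unbounded : ∀ {a : ℕ → ℕ} {m} → 0 < m →
  Unbounded (λ n → 1 < gcd (a n) m) → Unbounded (λ n → gcd (a n) m ≡ 1) →
  Unbounded (λ n → GcdConditions a (2 + n) m)
gcdConditions-unbounded {a} {m} 0<m shares coprime N =
  let s , N≤s , share[s] = shares N
      e , s<e , coprime[e] = coprime (suc s)
      k , s≤k , share[k] , ¬share[1+k] =
        ∃-exit {P = λ i → 1 < gcd (a i) m} (λ i → 1 <? gcd (a i) m)
               (<⇒≤ s<e) share[s] (λ share[e] → >⇒≢ share[e] coprime[e])
  in k , ≤-trans N≤s s≤k , share[k] , ≯1⇒gcd≡1 {a (suc k)} 0<m ¬share[1+k]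

module YellowstoneProperties {a : ℕ → ℕ} (isYellowstone : IsYellowstone a) where

  private
    a[1]≡1 : a 1 ≡ 1
    a[1]≡1 = proj₁ isYellowstone
    a[2]≡2 : a 2 ≡ 2
    a[2]≡2 = proj₁ (proj₂ isYellowstone)
    a[3]≡3 : a 3 ≡ 3
    a[3]≡3 = proj₁ (proj₂ (proj₂ isYellowstone))

    rule : ∀ n → 2 ≤ n → Admissible a (2 + n) (a (2 + n))
                       × (∀ k → Admissible a (2 + n) k → a (2 + n) ≤ k)
    rule n 2≤n = proj₂ (proj₂ (proj₂ isYellowstone)) (2 + n) (s≤s (s≤s 2≤n))

  positive : ∀ n → 1 ≤ n → 0 < a n
  positive 1 _ = subst (0 <_) (sym a[1]≡1) (s≤s z≤n)
  positive 2 _ = subst (0 <_) (sym a[2]≡2) (s≤s z≤n)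
  positive 3 _ = subst (0 <_) (sym a[3]≡3) (s≤s z≤n)
  positive (suc (suc n@(suc (suc _)))) _ = proj₁ (proj₁ (rule n (s≤s (s≤s z≤n))))

  distinct : ∀ {i j} → 1 ≤ i → i < j → a i ≢ a j
  distinct {i} {suc (suc n@(suc (suc _)))} 1≤i i<j =
    proj₁ (proj₂ (proj₁ (rule n (s≤s (s≤s z≤n))))) i 1≤i i<j
  distinct {1} {2} _ _ a[1]≡a[2] = contradiction (trans (sym a[1]≡1) (trans a[1]≡a[2] a[2]≡2)) λ ()
  distinct {1} {3} _ _ a[1]≡a[3] = contradiction (trans (sym a[1]≡1) (trans a[1]≡a[3] a[3]≡3)) λ ()
  distinct {2} {3} _ _ a[2]≡a[3] = contradiction (trans (sym a[2]≡2) (trans a[2]≡a[3] a[3]≡3)) λ ()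
  distinct {suc (suc (suc _))} {3} _ (s≤s (s≤s (s≤s ())))
  distinct {suc (suc _)}       {2} _ (s≤s (s≤s ()))
  distinct {suc _}             {1} _ (s≤s ())

  injective : ∀ i j → 1 ≤ i → 1 ≤ j → a i ≡ a j → i ≡ j
  injective i j 1≤i 1≤j a[i]≡a[j] with <-cmp i j
  ... | tri< i<j _ _ = contradiction a[i]≡a[j] (distinct 1≤i i<j)
  ... | tri≈ _ i≡j _ = i≡j
  ... | tri> _ _ j<i = contradiction (sym a[i]≡a[j]) (distinct 1≤j j<i)

  consecutive-coprime : ∀ {n} → 2 ≤ n → Coprime (a n) (a (suc n))
  consecutive-coprime {2} _ =
    gcd≡1⇒coprime (subst₂ (λ x y → gcd x y ≡ 1) (sym a[2]≡2) (sym a[3]≡3) refl)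
  consecutive-coprime {1} (s≤s ())
  consecutive-coprime {suc n@(suc (suc _))} _ =
    gcd≡1⇒coprime (proj₂ (proj₂ (proj₂ (proj₁ (rule n (s≤s (s≤s z≤n)))))))

  shares-with-second-predecessor : ∀ {n} → 2 ≤ n → 1 < gcd (a n) (a (2 + n))
  shares-with-second-predecessor {n} 2≤n = proj₁ (proj₂ (proj₂ (proj₁ (rule n 2≤n))))

  ≤-admissible : ∀ {n k} → 2 ≤ n → Admissible a (2 + n) k → a (2 + n) ≤ k
  ≤-admissible {n} 2≤n = proj₂ (rule n 2≤n) _

  <-skipped : ∀ {n m} → 2 ≤ n → 0 < m → (∀ i → 1 ≤ i → i ≤ 2 + n → a i ≢ m) →
              GcdConditions a (2 + n) m → a (2 + n) < m
  <-skipped {n} 2≤n 0<m absent gcds =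
    ≤∧≢⇒< (≤-admissible 2≤n (0<m , (λ i 1≤i i<2+n → absent i 1≤i (<⇒≤ i<2+n)) , gcds))
          (absent (2 + n) (s≤s z≤n) ≤-refl)

  appears-if-gcdConditions-unbounded : ∀ {m} → 0 < m →
    Unbounded (λ n → GcdConditions a (2 + n) m) → ∃[ n ] (1 ≤ n × a n ≡ m)
  appears-if-gcdConditions-unbounded {m} 0<m unbounded =
    let ι , ι↑ , 2≤ι₀ , ι-gcds = unbounded⇒enumeration unbounded 2 in search ι ι↑ 2≤ι₀ ι-gcds
    where
    search : ∀ ι → StrictlyIncreasing ι → 2 ≤ ι 0 → (∀ j → GcdConditions a (2 + ι j) m) →
             ∃[ n ] (1 ≤ n × a n ≡ m)
    search ι ι↑ 2≤ι₀ ι-gcds with anyUpTo? (λ i → (1 ≤? i) ×-dec (a i ≟ m)) (3 + ι m)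
    ... | yes (n , _ , 1≤n , a[n]≡m) = n , 1≤n , a[n]≡m
    ... | no absent =
      let i , j , i<j , same-value = pigeonhole (λ j → a (2 + ι j)) small
      in contradiction same-value
           (distinct (s≤s z≤n) (+-monoʳ-< 2 (strictlyIncreasing-< ι↑ i<j)))
      where
      small : ∀ j → j ≤ m → a (2 + ι j) < m
      small j j≤m = <-skipped (≤-trans 2≤ι₀ (strictlyIncreasing-monotone ι↑ z≤n)) 0<m
        (λ i 1≤i i≤2+ι[j] a[i]≡m → absent
          (i , s≤s (≤-trans i≤2+ι[j] (+-monoʳ-≤ 2 (strictlyIncreasing-monotone ι↑ j≤m))) ,
           1≤i , a[i]≡m))
        (ι-gcds j)

  module _ {p} (p-prime : Prime p) (N : ℕ) where

    private
      N₀ S C B : ℕ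
      N₀ = 2 + N
      S = sumBelow a N₀
      C = p ^ suc S
      B = suc (C * C)

      block : ℕ → ℕ
      block j = j * 4 + N₀

      X : ℕ
      X = 6 + block B

      S<C : S < C
      S<C = <-trans (n<1+n S) (n<m^n (prime⇒2≤ p-prime) (suc S))

      pick : ℕ → ℕ
      pick j with a (4 + block j) ≤? C * C
      ... | yes _ = 4 + block j
      ... | no  _ = 6 + block j

      pick-bounds : ∀ j → 4 + block j ≤ pick j × pick j ≤ 6 + block j
      pick-bounds j with a (4 + block j) ≤? C * C
      ... | yes _ = ≤-refl , m≤n+m (4 + block j) 2
      ... | no  _ = m≤n+m (4 + block j) 2 , ≤-refl

      pick↑ : StrictlyIncreasing pick
      pick↑ j = <-≤-trans (s≤s (≤-trans (proj₂ (pick-bounds j)) (m≤n+m _ 1)))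
                          (proj₁ (pick-bounds (suc j)))

      module _ (gap : ∀ i → N ≤ i → i ≤ X → ¬ p ∣ a i) where

        N₀≤⇒2≤ : ∀ {n} → N₀ ≤ n → 2 ≤ n
        N₀≤⇒2≤ N₀≤n = ≤-trans (m≤m+n 2 N) N₀≤n

        term≤t*C : ∀ {m t} → N₀ ≤ m → suc m ≤ X → 2 ≤ t → t ∣ a m → a (2 + m) ≤ t * C
        term≤t*C {m} {t} N₀≤m 1+m≤X 2≤t t∣a[m] =
          ≤-admissible (N₀≤⇒2≤ N₀≤m)
            (0<tC , fresh , 1<gcd 2≤t t∣a[m] (m∣m*n C) 0<tC ,
             coprime⇒gcd≡1 (coprime-*ʳ a[1+m]⊥t a[1+m]⊥C))
          where
          instance
            t≢0 : NonZero t
            t≢0 = >-nonZero (≤-trans (s≤s z≤n) 2≤t)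
          C≤tC : C ≤ t * C
          C≤tC = m≤n*m C t
          0<tC : 0 < t * C
          0<tC = <-≤-trans (≤-<-trans z≤n S<C) C≤tC
          fresh : ∀ i → 1 ≤ i → i < 2 + m → a i ≢ t * C
          fresh i _ i<2+m a[i]≡tC with i <? N₀
          ... | yes i<N₀ =
            <⇒≱ (<-≤-trans S<C C≤tC) (subst (_≤ S) a[i]≡tC (≤-sumBelow a i<N₀))
          ... | no  i≮N₀ =
            gap i (≤-trans (m≤n+m N 2) (≮⇒≥ i≮N₀)) (≤-trans (≤-pred i<2+m) 1+m≤X)
                (subst (p ∣_) (sym a[i]≡tC) (∣n⇒∣m*n t (m∣m*n (p ^ S))))
          a[1+m]⊥t : Coprime (a (suc m)) t
          a[1+m]⊥t (d∣a[1+m] , d∣t) =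
            consecutive-coprime (N₀≤⇒2≤ N₀≤m) (∣-trans d∣t t∣a[m] , d∣a[1+m])
          p∤a[1+m] : ¬ p ∣ a (suc m)
          p∤a[1+m] = gap (suc m) (≤-trans (m≤n+m N 2) (m≤n⇒m≤1+n N₀≤m)) 1+m≤X
          a[1+m]⊥C : Coprime (a (suc m)) C
          a[1+m]⊥C = coprime-^ʳ (∤⇒coprime p-prime p∤a[1+m]) (suc S)

        -- Write a(m+2) = u·t with t a common prime factor of a(m) and a(m+2):
        -- u ≤ C by term≤t*C at m, while u ≥ 2 would give a(m+4) ≤ u·C ≤ C².
        prime-before-large : ∀ {m} → N₀ ≤ m → 3 + m ≤ X → C * C < a (4 + m) →
                             ∃[ t ] (Prime t × t ∣ a m × a (2 + m) ≡ t)
        prime-before-large {m} N₀≤m 3+m≤X large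
          with 1<gcd⇒∃-prime (shares-with-second-predecessor (N₀≤⇒2≤ N₀≤m))
        ... | t , t-prime , t∣a[m] , divides u a[2+m]≡ut =
          t , t-prime , t∣a[m] ,
          trans a[2+m]≡ut (trans (cong (_* t) (u≡1 u a[2+m]≡ut u≤C)) (*-identityˡ t))
          where
          instance
            t≢0 : NonZero t
            t≢0 = prime⇒nonZero t-prime
          u≤C : u ≤ C
          u≤C = *-cancelʳ-≤ u C t (subst₂ _≤_ a[2+m]≡ut (*-comm t C)
                  (term≤t*C N₀≤m (≤-trans (m≤n+m _ 2) 3+m≤X) (prime⇒2≤ t-prime) t∣a[m]))
          u≡1 : ∀ v → a (2 + m) ≡ v * t → v ≤ C → v ≡ 1
          u≡1 zero a[2+m]≡0 _ = contradiction a[2+m]≡0 (>⇒≢ (positive (2 + m) (s≤s z≤n)))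
          u≡1 (suc zero) _ _ = refl
          u≡1 v@(suc (suc _)) a[2+m]≡vt v≤C = contradiction large (≤⇒≯ (begin
            a (4 + m) ≤⟨ term≤t*C (≤-trans N₀≤m (m≤n+m m 2)) 3+m≤X (s≤s (s≤s z≤n))
                                  (divides t (trans a[2+m]≡vt (*-comm v t))) ⟩
            v * C     ≤⟨ *-monoˡ-≤ C v≤C ⟩
            C * C     ∎))
            where open ≤-Reasoning

        ¬two-large : ∀ {m} → N₀ ≤ m → 5 + m ≤ X → C * C < a (4 + m) → ¬ C * C < a (6 + m)
        ¬two-large {m} N₀≤m 5+m≤X large₄ large₆ =
          let t , t-prime , _ , a[2+m]≡t =
                prime-before-large N₀≤m (≤-trans (m≤n+m _ 2) 5+m≤X) large₄
              t′ , t′-prime , t′∣a[2+m] , a[4+m]≡t′ =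
                prime-before-large (≤-trans N₀≤m (m≤n+m m 2)) 5+m≤X large₆
              t′≡t = prime∣prime⇒≡ t′-prime t-prime (subst (t′ ∣_) a[2+m]≡t t′∣a[2+m])
          in distinct (s≤s z≤n) (+-monoˡ-< m (s≤s (s≤s (s≤s z≤n))))
               (trans a[2+m]≡t (trans (sym t′≡t) (sym a[4+m]≡t′)))

        block-bounds : ∀ {j} → j ≤ B → N₀ ≤ block j × 5 + block j ≤ X
        block-bounds {j} j≤B =
          m≤n+m N₀ (j * 4) , ≤-trans (n≤1+n _) (+-monoʳ-≤ 6 (+-monoˡ-≤ N₀ (*-monoˡ-≤ 4 j≤B)))

        pick-small : ∀ j → j ≤ B → a (pick j) < B
        pick-small j j≤B with a (4 + block j) ≤? C * C
        ... | yes small = s≤s small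
        ... | no  large =
          s≤s (≮⇒≥ (¬two-large (proj₁ (block-bounds j≤B)) (proj₂ (block-bounds j≤B)) (≰⇒> large)))

        gap-absurd : ⊥
        gap-absurd =
          let i , j , i<j , same-value = pigeonhole (λ j → a (pick j)) pick-small
          in distinct (≤-trans (s≤s z≤n) (proj₁ (pick-bounds i))) (strictlyIncreasing-< pick↑ i<j)
                      same-value

    divides-term-beyond : ∃[ n ] (N ≤ n × p ∣ a n)
    divides-term-beyond with anyUpTo? (λ i → (N ≤? i) ×-dec (p ∣? a i)) (suc X)
    ... | yes (n , _ , N≤n , p∣a[n]) = n , N≤n , p∣a[n]
    ... | no none = ⊥-elim (gap-absurd λ i N≤i i≤X p∣a[i] → none (i , s≤s i≤X , N≤i , p∣a[i]))

  prime-appears : ∀ {p} → Prime p → ∃[ n ] (1 ≤ n × a n ≡ p)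
  prime-appears {p} p-prime =
    appears-if-gcdConditions-unbounded 0<p (gcdConditions-unbounded {a} 0<p shares coprime)
    where
    0<p : 0 < p
    0<p = ≤-trans (s≤s z≤n) (prime⇒2≤ p-prime)
    shares : Unbounded (λ n → 1 < gcd (a n) p)
    shares N =
      let n , N≤n , p∣a[n] = divides-term-beyond p-prime N
      in n , N≤n , 1<gcd (prime⇒2≤ p-prime) p∣a[n] ∣-refl 0<p
    coprime : Unbounded (λ n → gcd (a n) p ≡ 1)
    coprime N =
      let n , 2+N≤n , p∣a[n] = divides-term-beyond p-prime (2 + N)
          coprime-n = consecutive-coprime (≤-trans (m≤m+n 2 N) 2+N≤n)
          p∤a[1+n] p∣a[1+n] = ¬prime[1] (subst Prime (coprime-n (p∣a[n] , p∣a[1+n])) p-prime)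
      in suc n , ≤-trans (m≤n+m N 2) (m≤n⇒m≤1+n 2+N≤n) ,
         coprime⇒gcd≡1 (∤⇒coprime p-prime p∤a[1+n])

  appears : ∀ m → 0 < m → ∃[ n ] (1 ≤ n × a n ≡ m)
  appears 1 _ = 1 , ≤-refl , a[1]≡1
  appears m@(suc (suc _)) 0<m =
    appears-if-gcdConditions-unbounded 0<m (gcdConditions-unbounded {a} 0<m shares coprime)
    where
    shares : Unbounded (λ n → 1 < gcd (a n) m)
    shares N =
      let p , p-prime , p∣m = ∃-prime-divisor (s≤s (s≤s z≤n))
          n , N≤n , p∣a[n] = divides-term-beyond p-prime N
      in n , N≤n , 1<gcd (prime⇒2≤ p-prime) p∣a[n] p∣m 0<m
    -- the positions of primes exceeding m and every term before N
    coprime : Unbounded (λ n → gcd (a n) m ≡ 1)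
    coprime N =
      let q , q-prime , large = ∃-prime> (sumBelow a N + m)
          n , _ , a[n]≡q = prime-appears q-prime
          N≤n = ≮⇒≥ λ n<N → <⇒≱ (≤-<-trans (m≤m+n _ m) large)
                                  (subst (_≤ sumBelow a N) a[n]≡q (≤-sumBelow a n<N))
          m<q = ≤-<-trans (m≤n+m m _) large
      in n , N≤n ,
         subst (λ x → gcd x m ≡ 1) (sym a[n]≡q) (coprime⇒gcd≡1 (prime⇒coprime q-prime m<q))

  isPermOfPositives : IsPermOfPositives a
  isPermOfPositives = positive , appears , injective

theorem1 : (∃[ a ] IsYellowstone a) × (∀ (a : ℕ → ℕ) → IsYellowstone a → IsPermOfPositives a)
theorem1 = (yellowstone , yellowstone-isYellowstone) , λ a isYellowstone →
  YellowstoneProperties.isPermOfPositives isYellowstone
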